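{- Let $a$ be a nonincreasing integer list of length $n$ and $a'$ an integer list such that $a$ is obtained from $a'$ by a unit $(i,j)$-transfer. Then $N_3(a)\ge N_3(a')$. If moreover $a'$ is graphic, then $N_3(a)>N_3(a')$.
   Context: For an integer list $a=(a_1,\dots,a_n)$, a graph realization is a simple graph (no loops, no multiple edges) on labeled vertices $v_1,\dots,v_n$ with $\deg(v_i)=a_i$; $a$ is graphic if one exists, and $N_3(a)$ denotes the number of graph realizations ($0$ if none). Unit $(i,j)$-transfer: for $1\le i<j\le n$ with $a'_i\ge a'_j+2$, the list $a'-e_i+e_j$ ($e_i$ the $i$th unit vector). -}

module Defs where

open import Data.Nat as ℕ using (ℕ; zero; suc)
open import Data.Integer as ℤ using (ℤ; +_)
open import Data.Fin as Fin using (Fin)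
open import Data.Fin.Properties using (all?; _≟_)
open import Data.Bool using (Bool; true; false; if_then_else_)
open import Data.List using (List; []; _∷_; _++_; map; concatMap; length; filter; allFin)
open import Data.Vec using (Vec; []; _∷_; toList; lookup)
open import Data.Product using (_×_; _,_; ∃)
open import Relation.Nullary.Decidable using (⌊_⌋; Dec)
open import Relation.Binary.PropositionalEquality using (_≡_; _≢_)

pairs : (n : ℕ) → List (Fin n × Fin n)
pairs n = concatMap (λ i → concatMap (λ j → if ⌊ i Fin.<? j ⌋ then (i , j) ∷ [] else []) (allFin n)) (allFin n)

-- A simple graph on labeled vertices v_1..v_n: a choice, for every pair {i,j}
-- (i < j), of whether the edge ij is present.  (No loops, no multi-edges.)
Graph : ℕ → Set
Graph n = Vec Bool (length (pairs n))

edgesAux : ∀ {n} → List (Fin n × Fin n) → List Bool → List (Fin n × Fin n)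
edgesAux [] _ = []
edgesAux (_ ∷ _) [] = []
edgesAux (p ∷ ps) (true ∷ bs) = p ∷ edgesAux ps bs
edgesAux (p ∷ ps) (false ∷ bs) = edgesAux ps bs

edges : ∀ {n} → Graph n → List (Fin n × Fin n)
edges {n} g = edgesAux (pairs n) (toList g)

incident : ∀ {n} → Fin n → List (Fin n × Fin n) → ℕ
incident v [] = 0
incident v ((i , j) ∷ es) =
  (if ⌊ i ≟ v ⌋ then 1 else if ⌊ j ≟ v ⌋ then 1 else 0) ℕ.+ incident v es

deg : ∀ {n} → Graph n → Fin n → ℕ
deg g v = incident v (edges g)

Realizes : ∀ {n} → Vec ℤ n → Graph n → Set
Realizes a g = ∀ v → + deg g v ≡ lookup a v

realizes? : ∀ {n} (a : Vec ℤ n) (g : Graph n) → Dec (Realizes a g)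
realizes? a g = all? (λ v → + deg g v ℤ.≟ lookup a v)

allVecs : (m : ℕ) → List (Vec Bool m)
allVecs zero = [] ∷ []
allVecs (suc m) = map (true ∷_) (allVecs m) ++ map (false ∷_) (allVecs m)

allGraphs : (n : ℕ) → List (Graph n)
allGraphs n = allVecs (length (pairs n))

N₃ : ∀ {n} → Vec ℤ n → ℕ
N₃ {n} a = length (filter (realizes? a) (allGraphs n))

Graphic : ∀ {n} → Vec ℤ n → Set
Graphic {n} a = ∃ λ (g : Graph n) → Realizes a g

Nonincreasing : ∀ {n} → Vec ℤ n → Set
Nonincreasing a = ∀ k l → k Fin.≤ l → lookup a l ℤ.≤ lookup a k

UnitTransfer : ∀ {n} → Vec ℤ n → Fin n → Fin n → Vec ℤ n → Set
UnitTransfer a' i j a =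
  (i Fin.< j) ×
  (lookup a' j ℤ.+ + 2 ℤ.≤ lookup a' i) ×
  (lookup a i ≡ lookup a' i ℤ.- + 1) ×
  (lookup a j ≡ lookup a' j ℤ.+ + 1) ×
  (∀ k → k ≢ i → k ≢ j → lookup a k ≡ lookup a' k)

-- Fix a realization g of a′. Label each vertex w ∉ {i, j} adjacent to exactly one of i, j by up
-- (adjacent to i) or dn (adjacent to j); then deg i − deg j = #up − #dn ≥ 2. Read the labels in
-- vertex order as a walk that starts at 1, steps down at up and up at dn, and swap the i/j-edges of
-- every vertex passed before the walk first hits 0. Exactly one more up than dn is swapped, so i
-- loses an edge, j gains one and the result realizes a. The swapped labels, read with up and dn
-- exchanged, trace the same walk, so g is recovered: N₃(a′) ≤ N₃(a). If a′ is graphic, relabel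
-- one of its realizations with one up fewer and all ups first: this realizes a, and its walk (up
-- and dn exchanged) never returns to 0, so it lies outside the image and the inequality is strict.

module Submission where

open import Defs
open import Data.Bool using (Bool; true; false; not; _∧_; _∨_; _xor_; if_then_else_)
open import Data.Bool.Properties
  using (∧-zeroʳ; ∧-identityʳ; ∨-zeroʳ; ∨-comm; xor-identityʳ; xor-comm; xor-assoc; xor-same; ¬-not)
open import Data.Empty using (⊥; ⊥-elim)
open import Data.Fin as Fin using (Fin; zero; suc)
open import Data.Fin.Properties using (_≟_)
import Data.Fin.Properties as Finₚ
open import Data.Integer as ℤ using (ℤ)
import Data.Integer.Properties as ℤₚ
open import Data.List using (List; []; _∷_; _++_; map; filter; length; concatMap; allFin)
open import Data.List.Properties using (length-map; length-++)
open import Data.List.Membership.Propositional using (_∈_; find; lose)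
open import Data.List.Membership.Propositional.Properties
  using (∈-concatMap⁺; ∈-concatMap⁻; ∈-allFin; ∈-++⁻; ∈-++⁺ˡ; ∈-++⁺ʳ; ∈-∃++; ∈-map⁺; ∈-map⁻; ∈-filter⁺; ∈-filter⁻)
open import Data.List.Relation.Binary.Subset.Propositional using (_⊆_)
open import Data.List.Relation.Unary.All as All using (All; []; _∷_)
open import Data.List.Relation.Unary.AllPairs using ([]; _∷_)
open import Data.List.Relation.Unary.Any using (Any; here; there)
open import Data.List.Relation.Unary.Unique.Propositional using (Unique)
import Data.List.Relation.Unary.Unique.Propositional.Properties as Unique
open import Data.List.Relation.Unary.Unique.Propositional.Properties using (allFin⁺)
open import Data.Nat using (ℕ; zero; suc; _+_; _*_; _≤_; _<_; z≤n; s≤s)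
open import Data.Nat.Properties
  using ( ≤-trans; ≤-reflexive; ≤-pred; <-irrefl; n≤1+n; m≤m+n; +-monoˡ-≤
        ; +-suc; +-comm; +-assoc; +-identityʳ; +-cancelˡ-≡; +-cancelʳ-≡; +-cancelˡ-≤; +-*-semiring)
open import Data.Nat.Tactic.RingSolver using (solve-∀)
open import Algebra.Properties.Semiring.Sum +-*-semiring
  using (sum; sum-cong-≗; ∑-distrib-+; *-distribˡ-sum; sum-replicate-zero)
open import Data.Product using (_×_; _,_; proj₁; proj₂; ∃; uncurry)
open import Data.Product.Properties using (≡-dec; ,-injectiveˡ; ,-injectiveʳ)
open import Data.Sum using (_⊎_; inj₁; inj₂)
open import Data.Unit using (⊤; tt)
open import Data.Vec as Vec using (Vec; []; _∷_; lookup; toList; tabulate)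
open import Data.Vec.Properties using (lookup∘tabulate; tabulate∘lookup; tabulate-cong; lookup-zipWith)
open import Data.Vec.Relation.Binary.Pointwise.Inductive as Pointwise using (Pointwise; []; _∷_)
open import Function using (_∘_; case_of_)
open import Relation.Binary using (tri<; tri≈; tri>)
open import Relation.Binary.Definitions using (DecidableEquality)
open import Relation.Binary.PropositionalEquality
open import Relation.Nullary using (¬_; Dec; yes; no; does)
open import Relation.Nullary.Decidable using (⌊_⌋; ⌊⌋-map′; dec-true; dec-false)
open import Relation.Unary using (Pred; Decidable)

-- Counting through an injection

module _ {A : Set} where

  length-mono-⊆ : {xs ys : List A} → Unique xs → xs ⊆ ys → length xs ≤ length ys
  length-mono-⊆ {[]} _ _ = z≤n
  length-mono-⊆ {x ∷ xs} {ys} (x∉xs ∷ xs!) xs⊆ys with ∈-∃++ (xs⊆ys (here refl))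
  ... | l , r , refl = begin
    suc (length xs)      ≤⟨ s≤s (length-mono-⊆ xs! xs⊆l++r) ⟩
    suc (length (l ++ r)) ≡⟨ cong suc (length-++ l) ⟩
    suc (length l + length r) ≡⟨ +-suc (length l) (length r) ⟨
    length l + length (x ∷ r) ≡⟨ length-++ l ⟨
    length (l ++ x ∷ r) ∎
    where
    open Data.Nat.Properties.≤-Reasoning
    xs⊆l++r : xs ⊆ l ++ r
    xs⊆l++r y∈xs with ∈-++⁻ l (xs⊆ys (there y∈xs))
    ... | inj₁ y∈l = ∈-++⁺ˡ y∈l
    ... | inj₂ (here refl) = ⊥-elim (All.lookup x∉xs y∈xs refl)
    ... | inj₂ (there y∈r) = ∈-++⁺ʳ l y∈r

  Unique-concatMap : {B : Set} {f : B → List A} (key : A → B) →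
                     (∀ x y → y ∈ f x → key y ≡ x) → (∀ x → Unique (f x)) →
                     ∀ {xs} → Unique xs → Unique (concatMap f xs)
  Unique-concatMap key key-∈ f! {[]} [] = []
  Unique-concatMap {f = f} key key-∈ f! {x ∷ xs} (x∉xs ∷ xs!) =
    Unique.++⁺ (f! x) (Unique-concatMap key key-∈ f! xs!) disjoint
    where
    disjoint : ∀ {y} → ¬ (y ∈ f x × y ∈ concatMap f xs)
    disjoint {y} (y∈fx , y∈fxs) =
      let x′ , x′∈xs , y∈fx′ = find (∈-concatMap⁻ f {xs = xs} y∈fxs)
      in All.lookup x∉xs x′∈xs (trans (sym (key-∈ x y y∈fx)) (key-∈ x′ y y∈fx′))

  module CountByInjection
    (xs : List A) (xs! : Unique xs) (∈-xs : ∀ x → x ∈ xs)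
    {ℓ} {P Q : Pred A ℓ} (P? : Decidable P) (Q? : Decidable Q)
    (f g : A → A) (g∘f : ∀ x → g (f x) ≡ x) (f-resp : ∀ {x} → P x → Q (f x))
    where

    private
      image : List A
      image = map f (filter P? xs)

      image! : Unique image
      image! = Unique.map⁺ f-injective (Unique.filter⁺ P? xs!)
        where
        f-injective : ∀ {x y} → f x ≡ f y → x ≡ y
        f-injective {x} {y} fx≡fy = trans (sym (g∘f x)) (trans (cong g fx≡fy) (g∘f y))

      image⊆ : image ⊆ filter Q? xs
      image⊆ y∈image with ∈-map⁻ f y∈image
      ... | x , x∈ , refl = ∈-filter⁺ Q? (∈-xs (f x)) (f-resp (proj₂ (∈-filter⁻ P? {xs = xs} x∈)))

    length-filter-≤ : length (filter P? xs) ≤ length (filter Q? xs)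
    length-filter-≤ =
      ≤-trans (≤-reflexive (sym (length-map f (filter P? xs)))) (length-mono-⊆ image! image⊆)

    length-filter-< : (y : A) → Q y → (∀ x → P x → f x ≢ y) →
                      length (filter P? xs) < length (filter Q? xs)
    length-filter-< y Qy y∉image =
      ≤-trans (s≤s (≤-reflexive (sym (length-map f (filter P? xs)))))
              (length-mono-⊆ (All.tabulate y≢ ∷ image!) y∷image⊆)
      where
      y≢ : ∀ {z} → z ∈ image → y ≢ z
      y≢ z∈image refl with ∈-map⁻ f z∈image
      ... | x , x∈ , refl = y∉image x (proj₂ (∈-filter⁻ P? {xs = xs} x∈)) refl
      y∷image⊆ : y ∷ image ⊆ filter Q? xs
      y∷image⊆ (here refl) = ∈-filter⁺ Q? (∈-xs y) Qy
      y∷image⊆ (there z∈image) = image⊆ z∈image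

allVecs-unique : ∀ m → Unique (allVecs m)
allVecs-unique zero = [] ∷ []
allVecs-unique (suc m) =
  Unique.++⁺ (Unique.map⁺ ∷-injectiveʳ (allVecs-unique m)) (Unique.map⁺ ∷-injectiveʳ (allVecs-unique m)) disjoint
  where
  ∷-injectiveʳ : ∀ {b} {x y : Vec Bool m} → b ∷ x ≡ b ∷ y → x ≡ y
  ∷-injectiveʳ refl = refl
  disjoint : ∀ {v} → ¬ (v ∈ map (true ∷_) (allVecs m) × v ∈ map (false ∷_) (allVecs m))
  disjoint (p , q) with ∈-map⁻ (true ∷_) p | ∈-map⁻ (false ∷_) q
  ... | _ , _ , refl | _ , _ , ()

∈-allVecs : ∀ m (v : Vec Bool m) → v ∈ allVecs m
∈-allVecs zero [] = here refl
∈-allVecs (suc m) (true ∷ v) = ∈-++⁺ˡ (∈-map⁺ (true ∷_) (∈-allVecs m v))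
∈-allVecs (suc m) (false ∷ v) = ∈-++⁺ʳ (map (true ∷_) (allVecs m)) (∈-map⁺ (false ∷_) (∈-allVecs m v))

-- Counting Boolean predicates on Fin m

bit : Bool → ℕ
bit true = 1
bit false = 0

count : ∀ {m} → (Fin m → Bool) → ℕ
count f = sum (bit ∘ f)

module _ {m : ℕ} where

  count-cong : {f g : Fin m → Bool} → (∀ u → f u ≡ g u) → count f ≡ count g
  count-cong f≗g = sum-cong-≗ (cong bit ∘ f≗g)

  count-false : {f : Fin m → Bool} → (∀ u → f u ≡ false) → count f ≡ 0
  count-false f≗false = trans (count-cong f≗false) (sum-replicate-zero m)

  count-split : (f p : Fin m → Bool) →
                count f ≡ count (λ u → f u ∧ p u) + count (λ u → f u ∧ not (p u))
  count-split f p =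
    trans (sum-cong-≗ (λ u → split (f u) (p u)))
          (∑-distrib-+ (λ u → bit (f u ∧ p u)) (λ u → bit (f u ∧ not (p u))))
    where
    split : ∀ x y → bit x ≡ bit (x ∧ y) + bit (x ∧ not y)
    split true true = refl
    split true false = refl
    split false _ = refl

  count-xor : (f g : Fin m → Bool) →
              count (λ u → f u xor g u) + 2 * count (λ u → f u ∧ g u) ≡ count f + count g
  count-xor f g = begin
    count (λ u → f u xor g u) + 2 * count (λ u → f u ∧ g u)
      ≡⟨ cong (count (λ u → f u xor g u) +_) (*-distribˡ-sum 2 (λ u → bit (f u ∧ g u))) ⟩
    count (λ u → f u xor g u) + sum (λ u → 2 * bit (f u ∧ g u))
      ≡⟨ ∑-distrib-+ (λ u → bit (f u xor g u)) (λ u → 2 * bit (f u ∧ g u)) ⟨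
    sum (λ u → bit (f u xor g u) + 2 * bit (f u ∧ g u))
      ≡⟨ sum-cong-≗ (λ u → xor-∧ (f u) (g u)) ⟩
    sum (λ u → bit (f u) + bit (g u))
      ≡⟨ ∑-distrib-+ (bit ∘ f) (bit ∘ g) ⟩
    count f + count g ∎
    where
    open ≡-Reasoning
    xor-∧ : ∀ x y → bit (x xor y) + 2 * bit (x ∧ y) ≡ bit x + bit y
    xor-∧ true true = refl
    xor-∧ true false = refl
    xor-∧ false true = refl
    xor-∧ false false = refl

  count-if : {p r : Fin m → Bool} (x : Bool) → (∀ u → p u ≡ true → r u ≡ false) →
             count (λ u → if p u then x else r u) ≡ count (λ u → x ∧ p u) + count r
  count-if {p} {r} x p⇒¬r =
    trans (sum-cong-≗ pointwise) (∑-distrib-+ (λ u → bit (x ∧ p u)) (bit ∘ r))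
    where
    pointwise : ∀ u → bit (if p u then x else r u) ≡ bit (x ∧ p u) + bit (r u)
    pointwise u with p u in pu
    ... | true rewrite p⇒¬r u pu | ∧-identityʳ x = sym (+-identityʳ (bit x))
    ... | false rewrite ∧-zeroʳ x = refl

count-point : ∀ {m} (c : Fin m) → count (λ u → ⌊ u ≟ c ⌋) ≡ 1
count-point {suc m} zero = cong suc (count-false {m} λ _ → refl)
count-point {suc m} (suc c) = trans (count-cong (λ u → ⌊⌋-map′ _ _ (u ≟ c))) (count-point c)

module _ {m : ℕ} where

  count-at : (f : Fin m → Bool) (c : Fin m) → count (λ u → f u ∧ ⌊ u ≟ c ⌋) ≡ bit (f c)
  count-at f c = trans (count-cong only-c) (at (f c))
    where
    only-c : ∀ u → f u ∧ ⌊ u ≟ c ⌋ ≡ f c ∧ ⌊ u ≟ c ⌋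
    only-c u with u ≟ c
    ... | yes refl = refl
    ... | no _ = trans (∧-zeroʳ (f u)) (sym (∧-zeroʳ (f c)))
    at : ∀ b → count (λ u → b ∧ ⌊ u ≟ c ⌋) ≡ bit b
    at true = count-point c
    at false = count-false {m} λ _ → refl

  count-at-pair : {i j : Fin m} → i ≢ j → (f : Fin m → Bool) →
                  count (λ u → f u ∧ (⌊ u ≟ i ⌋ ∨ ⌊ u ≟ j ⌋)) ≡ bit (f i) + bit (f j)
  count-at-pair {i} {j} i≢j f =
    trans (sum-cong-≗ disjoint)
          (trans (∑-distrib-+ (λ u → bit (f u ∧ ⌊ u ≟ i ⌋)) (λ u → bit (f u ∧ ⌊ u ≟ j ⌋)))
                 (cong₂ _+_ (count-at f i) (count-at f j)))
    where
    disjoint : ∀ u → bit (f u ∧ (⌊ u ≟ i ⌋ ∨ ⌊ u ≟ j ⌋)) ≡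
                     bit (f u ∧ ⌊ u ≟ i ⌋) + bit (f u ∧ ⌊ u ≟ j ⌋)
    disjoint u with f u | u ≟ i | u ≟ j
    ... | false | _ | _ = refl
    ... | true | yes refl | yes refl = ⊥-elim (i≢j refl)
    ... | true | yes _ | no _ = refl
    ... | true | no _ | yes _ = refl
    ... | true | no _ | no _ = refl

-- The ballot walk on sequences of up, nil and dn

data Trit : Set where
  up nil dn : Trit

swapT : Trit → Trit
swapT up = dn
swapT nil = nil
swapT dn = up

swapIf : Bool → Trit → Trit
swapIf true = swapT
swapIf false t = t

swapIf-nil : ∀ b → swapIf b nil ≡ nil
swapIf-nil true = refl
swapIf-nil false = refl

isUp isDn : Trit → Bool
isUp up = true
isUp _ = false
isDn dn = true
isDn _ = false

module _ {m : ℕ} where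

  swapAt : Vec Bool m → Vec Trit m → Vec Trit m
  swapAt = Vec.zipWith swapIf

  swapAll : Vec Trit m → Vec Trit m
  swapAll = Vec.map swapT

  ups dns : Vec Trit m → ℕ
  ups t = count (isUp ∘ lookup t)
  dns t = count (isDn ∘ lookup t)

  upsAt dnsAt : Vec Bool m → Vec Trit m → ℕ
  upsAt M t = count (λ u → lookup M u ∧ isUp (lookup t u))
  dnsAt M t = count (λ u → lookup M u ∧ isDn (lookup t u))

  Balanced : Vec Bool m → Vec Trit m → Set
  Balanced M t = upsAt M t ≡ dnsAt M t + 1

-- Read up as -1 and dn as +1: starting from k, the walk along t reaches 0.
Reaches : ∀ {m} → ℕ → Vec Trit m → Set
Reaches zero _ = ⊤
Reaches (suc k) [] = ⊥
Reaches (suc k) (up ∷ t) = Reaches k t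
Reaches (suc k) (nil ∷ t) = Reaches (suc k) t
Reaches (suc k) (dn ∷ t) = Reaches (suc (suc k)) t

-- The entries visited by that walk before it first reaches 0.
ballot : ∀ {m} → ℕ → Vec Trit m → Vec Bool m
ballot _ [] = []
ballot zero (_ ∷ t) = false ∷ ballot zero t
ballot (suc k) (up ∷ t) = true ∷ ballot k t
ballot (suc k) (nil ∷ t) = false ∷ ballot (suc k) t
ballot (suc k) (dn ∷ t) = true ∷ ballot (suc (suc k)) t

reaches : ∀ {m} k (t : Vec Trit m) → k + dns t ≤ ups t → Reaches k t
reaches zero t _ = tt
reaches (suc k) [] ()
reaches (suc k) (up ∷ t) (s≤s k+d≤u) = reaches k t k+d≤u
reaches (suc k) (nil ∷ t) k+d≤u = reaches (suc k) t k+d≤u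
reaches (suc k) (dn ∷ t) k+d≤u = reaches (suc (suc k)) t (≤-trans (≤-reflexive (sym (+-suc (suc k) (dns t)))) k+d≤u)

ballot-balanced : ∀ {m} k (t : Vec Trit m) → Reaches k t → upsAt (ballot k t) t ≡ dnsAt (ballot k t) t + k
ballot-balanced zero [] _ = refl
ballot-balanced zero (_ ∷ t) r = ballot-balanced zero t r
ballot-balanced (suc k) (up ∷ t) r = trans (cong suc (ballot-balanced k t r)) (sym (+-suc _ k))
ballot-balanced (suc k) (nil ∷ t) r = ballot-balanced (suc k) t r
ballot-balanced (suc k) (dn ∷ t) r = trans (ballot-balanced (suc (suc k)) t r) (+-suc _ (suc k))

-- On the visited entries swapAll undoes swapAt, so the walk retraces the same entries.
ballot-swapAll-swapAt : ∀ {m} k (t : Vec Trit m) → ballot k (swapAll (swapAt (ballot k t) t)) ≡ ballot k t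
ballot-swapAll-swapAt _ [] = refl
ballot-swapAll-swapAt zero (_ ∷ t) = cong (false ∷_) (ballot-swapAll-swapAt zero t)
ballot-swapAll-swapAt (suc k) (up ∷ t) = cong (true ∷_) (ballot-swapAll-swapAt k t)
ballot-swapAll-swapAt (suc k) (nil ∷ t) = cong (false ∷_) (ballot-swapAll-swapAt (suc k) t)
ballot-swapAll-swapAt (suc k) (dn ∷ t) = cong (true ∷_) (ballot-swapAll-swapAt (suc (suc k)) t)

reaches-swapAll-swapAt : ∀ {m} k (t : Vec Trit m) → Reaches k t → Reaches k (swapAll (swapAt (ballot k t) t))
reaches-swapAll-swapAt zero _ _ = tt
reaches-swapAll-swapAt (suc k) (up ∷ t) r = reaches-swapAll-swapAt k t r
reaches-swapAll-swapAt (suc k) (nil ∷ t) r = reaches-swapAll-swapAt (suc k) t r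
reaches-swapAll-swapAt (suc k) (dn ∷ t) r = reaches-swapAll-swapAt (suc (suc k)) t r

ups-swapAt : ∀ {m} (M : Vec Bool m) t → ups (swapAt M t) + upsAt M t ≡ ups t + dnsAt M t
ups-swapAt [] [] = refl
ups-swapAt (true ∷ M) (up ∷ t) = trans (+-suc _ _) (cong suc (ups-swapAt M t))
ups-swapAt (true ∷ M) (nil ∷ t) = ups-swapAt M t
ups-swapAt (true ∷ M) (dn ∷ t) = trans (cong suc (ups-swapAt M t)) (sym (+-suc _ _))
ups-swapAt (false ∷ M) (up ∷ t) = cong suc (ups-swapAt M t)
ups-swapAt (false ∷ M) (nil ∷ t) = ups-swapAt M t
ups-swapAt (false ∷ M) (dn ∷ t) = ups-swapAt M t

-- swapAt (sortMask c t) t turns the first c entries of t other than nil into up, the rest into dn.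
sortMask : ∀ {m} → ℕ → Vec Trit m → Vec Bool m
sortMask _ [] = []
sortMask c (nil ∷ t) = false ∷ sortMask c t
sortMask zero (up ∷ t) = true ∷ sortMask zero t
sortMask zero (dn ∷ t) = false ∷ sortMask zero t
sortMask (suc c) (up ∷ t) = false ∷ sortMask c t
sortMask (suc c) (dn ∷ t) = true ∷ sortMask c t

nonNil : Trit → Bool
nonNil nil = false
nonNil _ = true

SupportedAt : Bool → Trit → Set
SupportedAt b t = b ≡ true → nonNil t ≡ true

Supported : ∀ {m} → Vec Bool m → Vec Trit m → Set
Supported = Pointwise SupportedAt

ballot-supported : ∀ {m} k (t : Vec Trit m) → Supported (ballot k t) t
ballot-supported _ [] = []
ballot-supported zero (_ ∷ t) = (λ ()) ∷ ballot-supported zero t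
ballot-supported (suc k) (up ∷ t) = (λ _ → refl) ∷ ballot-supported k t
ballot-supported (suc k) (nil ∷ t) = (λ ()) ∷ ballot-supported (suc k) t
ballot-supported (suc k) (dn ∷ t) = (λ _ → refl) ∷ ballot-supported (suc (suc k)) t

sortMask-supported : ∀ {m} c (t : Vec Trit m) → Supported (sortMask c t) t
sortMask-supported _ [] = []
sortMask-supported c (nil ∷ t) = (λ ()) ∷ sortMask-supported c t
sortMask-supported zero (up ∷ t) = (λ _ → refl) ∷ sortMask-supported zero t
sortMask-supported zero (dn ∷ t) = (λ ()) ∷ sortMask-supported zero t
sortMask-supported (suc c) (up ∷ t) = (λ ()) ∷ sortMask-supported c t
sortMask-supported (suc c) (dn ∷ t) = (λ _ → refl) ∷ sortMask-supported c t

ups-sorted : ∀ {m} c (t : Vec Trit m) → c ≤ ups t + dns t → ups (swapAt (sortMask c t) t) ≡ c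
ups-sorted zero [] _ = refl
ups-sorted zero (nil ∷ t) _ = ups-sorted zero t z≤n
ups-sorted zero (up ∷ t) _ = ups-sorted zero t z≤n
ups-sorted zero (dn ∷ t) _ = ups-sorted zero t z≤n
ups-sorted (suc c) (nil ∷ t) c≤ = ups-sorted (suc c) t c≤
ups-sorted (suc c) (up ∷ t) (s≤s c≤) = cong suc (ups-sorted c t c≤)
ups-sorted (suc c) (dn ∷ t) c≤ =
  cong suc (ups-sorted c t (≤-pred (≤-trans c≤ (≤-reflexive (+-suc (ups t) (dns t))))))

sortMask-balanced : ∀ {m} c (t : Vec Trit m) → ups t ≡ suc c → Balanced (sortMask c t) t
sortMask-balanced c t ups≡ = +-cancelˡ-≡ c _ _ (begin
  c + upsAt M t                           ≡⟨ cong (_+ upsAt M t) (ups-sorted c t c≤) ⟨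
  ups (swapAt M t) + upsAt M t            ≡⟨ ups-swapAt M t ⟩
  ups t + dnsAt M t                       ≡⟨ cong (_+ dnsAt M t) ups≡ ⟩
  suc c + dnsAt M t                       ≡⟨ suc-shift c (dnsAt M t) ⟩
  c + (dnsAt M t + 1)                     ∎)
  where
  open ≡-Reasoning
  M : Vec Bool _
  M = sortMask c t
  c≤ : c ≤ ups t + dns t
  c≤ = ≤-trans (n≤1+n c) (≤-trans (≤-reflexive (sym ups≡)) (m≤m+n (ups t) (dns t)))
  suc-shift : ∀ c d → suc c + d ≡ c + (d + 1)
  suc-shift = solve-∀

private
  shift : ∀ c k → c + suc c + suc k ≡ c + c + suc (suc k)
  shift = solve-∀

reaches-swapAll-sorted : ∀ {m} k c (t : Vec Trit m) →
  Reaches (suc k) (swapAll (swapAt (sortMask c t) t)) → c + c + suc k ≤ ups t + dns t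
reaches-swapAll-sorted k c (nil ∷ t) r = reaches-swapAll-sorted k c t r
reaches-swapAll-sorted zero zero (up ∷ t) _ = s≤s z≤n
reaches-swapAll-sorted (suc k) zero (up ∷ t) r = s≤s (reaches-swapAll-sorted k zero t r)
reaches-swapAll-sorted zero zero (dn ∷ t) _ = ≤-trans (s≤s z≤n) (≤-reflexive (sym (+-suc (ups t) (dns t))))
reaches-swapAll-sorted (suc k) zero (dn ∷ t) r =
  ≤-trans (s≤s (reaches-swapAll-sorted k zero t r)) (≤-reflexive (sym (+-suc (ups t) (dns t))))
reaches-swapAll-sorted k (suc c) (up ∷ t) r =
  s≤s (≤-trans (≤-reflexive (shift c k)) (reaches-swapAll-sorted (suc k) c t r))
reaches-swapAll-sorted k (suc c) (dn ∷ t) r =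
  ≤-trans (s≤s (≤-trans (≤-reflexive (shift c k)) (reaches-swapAll-sorted (suc k) c t r)))
          (≤-reflexive (sym (+-suc (ups t) (dns t))))

NotBallotSwap : ∀ {m} → Vec Trit m → Set
NotBallotSwap t′ = ∀ s → Reaches 1 s → swapAt (ballot 1 s) s ≢ t′

-- After swapAll the sorted sequence starts with c dn-steps followed by only dns t + 1 ≤ c
-- up-steps, so its walk from 1 never reaches 0; swapped ballot sequences do reach 0.
sorted-not-ballot-swap : ∀ {m} c (t : Vec Trit m) → ups t ≡ suc c → dns t < c →
                         NotBallotSwap (swapAt (sortMask c t) t)
sorted-not-ballot-swap c t ups≡ dns<c s r eq = <-irrefl refl (≤-trans dns<c c≤dns)
  where
  reaches-sorted : Reaches 1 (swapAll (swapAt (sortMask c t) t))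
  reaches-sorted = subst (Reaches 1 ∘ swapAll) eq (reaches-swapAll-swapAt 1 s r)
  c≤dns : c ≤ dns t
  c≤dns = +-cancelˡ-≤ (suc c) c (dns t) (begin
    suc c + c          ≡⟨ +-comm 1 (c + c) ⟩
    c + c + 1          ≤⟨ reaches-swapAll-sorted 0 c t reaches-sorted ⟩
    ups t + dns t      ≡⟨ cong (_+ dns t) ups≡ ⟩
    suc c + dns t      ∎)
    where open Data.Nat.Properties.≤-Reasoning

unreachable-swap : ∀ {m} (t : Vec Trit m) → 2 + dns t ≤ ups t →
                   ∃ λ M → Supported M t × Balanced M t × NotBallotSwap (swapAt M t)
unreachable-swap t = by-ups (ups t) refl
  where
  by-ups : ∀ u → ups t ≡ u → 2 + dns t ≤ u →
           ∃ λ M → Supported M t × Balanced M t × NotBallotSwap (swapAt M t)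
  by-ups (suc c) ups≡ (s≤s dns<c) =
    sortMask c t , sortMask-supported c t , sortMask-balanced c t ups≡ ,
    sorted-not-ballot-swap c t ups≡ dns<c

-- Graphs as symmetric irreflexive relations

module _ {n : ℕ} where

  Ordered : Fin n × Fin n → Set
  Ordered (a , b) = a Fin.< b

  private
    row : Fin n → Fin n → List (Fin n × Fin n)
    row a b = if ⌊ a Fin.<? b ⌋ then (a , b) ∷ [] else []

    ∈-row⁻ : ∀ {a b p} → p ∈ row a b → p ≡ (a , b) × a Fin.< b
    ∈-row⁻ {a} {b} p∈ with a Fin.<? b
    ∈-row⁻ (here refl) | yes a<b = refl , a<b

    ∈-row⁺ : ∀ {a b} → a Fin.< b → (a , b) ∈ row a b
    ∈-row⁺ {a} {b} a<b with a Fin.<? b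
    ... | yes _ = here refl
    ... | no a≮b = ⊥-elim (a≮b a<b)

    row-unique : ∀ a b → Unique (row a b)
    row-unique a b with a Fin.<? b
    ... | yes _ = [] ∷ []
    ... | no _ = []

    ∈-row-inner : ∀ {a p} → p ∈ concatMap (row a) (allFin n) → ∃ λ b → p ∈ row a b
    ∈-row-inner p∈ = let b , _ , p∈row = find (∈-concatMap⁻ _ {xs = allFin n} p∈) in b , p∈row

    ∈-row-outer : ∀ {p} → p ∈ pairs n → ∃ λ a → p ∈ concatMap (row a) (allFin n)
    ∈-row-outer p∈ = let a , _ , p∈row = find (∈-concatMap⁻ _ {xs = allFin n} p∈) in a , p∈row

  ∈-pairs⁻ : ∀ {p} → p ∈ pairs n → Ordered p
  ∈-pairs⁻ p∈ with ∈-row-outer p∈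
  ... | a , p∈a with ∈-row-inner p∈a
  ... | b , p∈ab with ∈-row⁻ p∈ab
  ... | refl , a<b = a<b

  ∈-pairs⁺ : ∀ {a b} → a Fin.< b → (a , b) ∈ pairs n
  ∈-pairs⁺ {a} {b} a<b =
    ∈-concatMap⁺ _ (lose (∈-allFin a) (∈-concatMap⁺ (row a) (lose (∈-allFin b) (∈-row⁺ a<b))))

  pairs-unique : Unique (pairs n)
  pairs-unique = Unique-concatMap proj₁ first-row rows-unique (allFin⁺ n)
    where
    first-row : ∀ a p → p ∈ concatMap (row a) (allFin n) → proj₁ p ≡ a
    first-row a p p∈ with ∈-row-inner p∈
    ... | b , p∈ab with ∈-row⁻ p∈ab
    ... | refl , _ = refl
    rows-unique : ∀ a → Unique (concatMap (row a) (allFin n))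
    rows-unique a = Unique-concatMap proj₂ second-row (row-unique a) (allFin⁺ n)
      where
      second-row : ∀ b p → p ∈ row a b → proj₂ p ≡ b
      second-row b p p∈ with ∈-row⁻ p∈
      ... | refl , _ = refl

Vec-over : {A B : Set} → (A → B) → (xs : List A) → Vec B (length xs)
Vec-over f [] = []
Vec-over f (x ∷ xs) = f x ∷ Vec-over f xs

Vec-over-cong : {A B : Set} {f g : A → B} (xs : List A) → (∀ {x} → x ∈ xs → f x ≡ g x) →
                Vec-over f xs ≡ Vec-over g xs
Vec-over-cong [] _ = refl
Vec-over-cong (x ∷ xs) f≗g = cong₂ _∷_ (f≗g (here refl)) (Vec-over-cong xs (f≗g ∘ there))

module _ {n : ℕ} where

  private
    _≟ₚ_ : DecidableEquality (Fin n × Fin n)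
    _≟ₚ_ = ≡-dec _≟_ _≟_

  joins : Fin n × Fin n → Fin n → Fin n → Bool
  joins p u v = does (p ≟ₚ (u , v)) ∨ does (p ≟ₚ (v , u))

  joins-sym : ∀ p u v → joins p u v ≡ joins p v u
  joins-sym p u v = ∨-comm (does (p ≟ₚ (u , v))) (does (p ≟ₚ (v , u)))

  joins-refl : ∀ u v → joins (u , v) u v ≡ true
  joins-refl u v rewrite dec-true ((u , v) ≟ₚ (u , v)) refl = refl

  joins-≢ : ∀ p u v → p ≢ (u , v) → p ≢ (v , u) → joins p u v ≡ false
  joins-≢ p u v p≢uv p≢vu rewrite dec-false (p ≟ₚ (u , v)) p≢uv | dec-false (p ≟ₚ (v , u)) p≢vu = refl

  joins⁻ : ∀ {p u v} → joins p u v ≡ true → p ≡ (u , v) ⊎ p ≡ (v , u)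
  joins⁻ {p} {u} {v} j with p ≟ₚ (u , v) | p ≟ₚ (v , u)
  ... | yes p≡uv | _ = inj₁ p≡uv
  ... | no _ | yes p≡vu = inj₂ p≡vu

  joins-ordered : ∀ {p q u v} → Ordered p → Ordered q → joins p u v ≡ true → joins q u v ≡ true → p ≡ q
  joins-ordered {p} {q} {u} {v} p< q< jp jq with joins⁻ {p} jp | joins⁻ {q} jq
  ... | inj₁ refl | inj₁ refl = refl
  ... | inj₂ refl | inj₂ refl = refl
  ... | inj₁ refl | inj₂ refl = ⊥-elim (Finₚ.<-asym p< q<)
  ... | inj₂ refl | inj₁ refl = ⊥-elim (Finₚ.<-asym p< q<)

  -- The bit that xs assigns to {u, v} in ps, whichever orientation the pair has there.
  adjacentIn : List (Fin n × Fin n) → List Bool → Fin n → Fin n → Bool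
  adjacentIn (p ∷ ps) (x ∷ xs) u v = if joins p u v then x else adjacentIn ps xs u v
  adjacentIn _ _ _ _ = false

  adjacentIn-sym : ∀ ps xs u v → adjacentIn ps xs u v ≡ adjacentIn ps xs v u
  adjacentIn-sym [] _ u v = refl
  adjacentIn-sym (p ∷ ps) [] u v = refl
  adjacentIn-sym (p ∷ ps) (x ∷ xs) u v
    rewrite joins-sym p u v | adjacentIn-sym ps xs u v = refl

  adjacentIn-∉ : ∀ ps xs {u v} → (∀ {q} → q ∈ ps → joins q u v ≡ false) → adjacentIn ps xs u v ≡ false
  adjacentIn-∉ [] _ _ = refl
  adjacentIn-∉ (p ∷ ps) [] _ = refl
  adjacentIn-∉ (p ∷ ps) (x ∷ xs) ¬joins rewrite ¬joins (here refl) = adjacentIn-∉ ps xs (¬joins ∘ there)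

  adjacentIn-irrefl : ∀ {ps} xs → All Ordered ps → ∀ u → adjacentIn ps xs u u ≡ false
  adjacentIn-irrefl {ps} xs ps< u = adjacentIn-∉ ps xs λ q∈ → ¬-not λ j → loop (All.lookup ps< q∈) j
    where
    loop : ∀ {q} → Ordered q → joins q u u ≢ true
    loop {q} q< j with joins⁻ {q} {u} {u} j
    ... | inj₁ refl = Finₚ.<-irrefl refl q<
    ... | inj₂ refl = Finₚ.<-irrefl refl q<

  count-joins : ∀ {a b} → a ≢ b → ∀ v →
                count (joins (a , b) v) ≡ (if ⌊ a ≟ v ⌋ then 1 else if ⌊ b ≟ v ⌋ then 1 else 0)
  count-joins {a} {b} a≢b v = by-cases (a ≟ v) (b ≟ v)
    where
    by-cases : ∀ {v} (a≟v : Dec (a ≡ v)) (b≟v : Dec (b ≡ v)) →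
               count (joins (a , b) v) ≡ (if ⌊ a≟v ⌋ then 1 else if ⌊ b≟v ⌋ then 1 else 0)
    by-cases (yes refl) _ = trans (count-cong to-b) (count-point b)
      where
      to-b : ∀ w → joins (a , b) a w ≡ ⌊ w ≟ b ⌋
      to-b w with w ≟ b
      ... | yes refl = joins-refl a w
      ... | no w≢b = joins-≢ (a , b) a w (w≢b ∘ sym ∘ ,-injectiveʳ) (a≢b ∘ sym ∘ ,-injectiveʳ)
    by-cases (no _) (yes refl) = trans (count-cong to-a) (count-point a)
      where
      to-a : ∀ w → joins (a , b) b w ≡ ⌊ w ≟ a ⌋
      to-a w with w ≟ a
      ... | yes refl = trans (joins-sym (w , b) b w) (joins-refl w b)
      ... | no w≢a = joins-≢ (a , b) b w (a≢b ∘ ,-injectiveˡ) (w≢a ∘ sym ∘ ,-injectiveˡ)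
    by-cases (no a≢v) (no b≢v) =
      count-false {n} λ w → joins-≢ (a , b) _ w (a≢v ∘ ,-injectiveˡ) (b≢v ∘ ,-injectiveʳ)

  incident-adjacentIn : ∀ {ps} xs → Unique ps → All Ordered ps → ∀ v →
                        incident v (edgesAux ps xs) ≡ count (adjacentIn ps xs v)
  incident-adjacentIn {[]} _ _ _ v = sym (count-false {n} λ _ → refl)
  incident-adjacentIn {_ ∷ _} [] _ _ v = sym (count-false {n} λ _ → refl)
  incident-adjacentIn {(a , b) ∷ ps} (x ∷ xs) (ab∉ps ∷ ps!) (a<b ∷ ps<) v = begin
    incident v (edgesAux ((a , b) ∷ ps) (x ∷ xs))
      ≡⟨ incident-head x ⟩
    count (λ w → x ∧ joins (a , b) v w) + incident v (edgesAux ps xs)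
      ≡⟨ cong (count (λ w → x ∧ joins (a , b) v w) +_) (incident-adjacentIn xs ps! ps< v) ⟩
    count (λ w → x ∧ joins (a , b) v w) + count (adjacentIn ps xs v)
      ≡⟨ count-if x disjoint ⟨
    count (adjacentIn ((a , b) ∷ ps) (x ∷ xs) v) ∎
    where
    open ≡-Reasoning
    incident-head : ∀ x → incident v (edgesAux ((a , b) ∷ ps) (x ∷ xs)) ≡
                          count (λ w → x ∧ joins (a , b) v w) + incident v (edgesAux ps xs)
    incident-head true = cong (_+ incident v (edgesAux ps xs)) (sym (count-joins (Finₚ.<⇒≢ a<b) v))
    incident-head false = cong (_+ incident v (edgesAux ps xs)) (sym (count-false {n} λ _ → refl))
    disjoint : ∀ w → joins (a , b) v w ≡ true → adjacentIn ps xs v w ≡ false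
    disjoint w j = adjacentIn-∉ ps xs λ q∈ →
      ¬-not λ jq → All.lookup ab∉ps q∈ (joins-ordered a<b (All.lookup ps< q∈) j jq)

  adjacentIn-Vec-over : {E : Fin n → Fin n → Bool} → (∀ u v → E u v ≡ E v u) →
    ∀ ps {u v} → Any (λ p → joins p u v ≡ true) ps ⊎ E u v ≡ false →
    adjacentIn ps (toList (Vec-over (uncurry E) ps)) u v ≡ E u v
  adjacentIn-Vec-over E-sym [] (inj₂ E≡false) = sym E≡false
  adjacentIn-Vec-over E-sym (p ∷ ps) {u} {v} joined with joins p u v in j
  ... | true with joins⁻ {p} {u} {v} j
  ...   | inj₁ refl = refl
  ...   | inj₂ refl = E-sym v u
  adjacentIn-Vec-over E-sym (p ∷ ps) (inj₁ (here j′)) | false with () ← trans (sym j) j′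
  adjacentIn-Vec-over E-sym (p ∷ ps) (inj₁ (there joined)) | false = adjacentIn-Vec-over E-sym ps (inj₁ joined)
  adjacentIn-Vec-over E-sym (p ∷ ps) (inj₂ E≡false) | false = adjacentIn-Vec-over E-sym ps (inj₂ E≡false)

  Vec-over-adjacentIn : ∀ {ps} (xs : Vec Bool (length ps)) → Unique ps → All Ordered ps →
                        Vec-over (uncurry (adjacentIn ps (toList xs))) ps ≡ xs
  Vec-over-adjacentIn {[]} [] _ _ = refl
  Vec-over-adjacentIn {(a , b) ∷ ps} (x ∷ xs) (ab∉ps ∷ ps!) (a<b ∷ ps<) =
    cong₂ _∷_ (cong (if_then x else adjacentIn ps (toList xs) a b) (joins-refl a b))
              (trans (Vec-over-cong ps skip-head) (Vec-over-adjacentIn xs ps! ps<))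
    where
    skip-head : ∀ {q} → q ∈ ps → uncurry (adjacentIn ((a , b) ∷ ps) (x ∷ toList xs)) q ≡
                                   uncurry (adjacentIn ps (toList xs)) q
    skip-head {c , d} q∈ = cong (if_then x else adjacentIn ps (toList xs) c d) (¬-not λ j →
      All.lookup ab∉ps q∈ (joins-ordered a<b (All.lookup ps< q∈) j (joins-refl c d)))

  pairs-ordered : All Ordered (pairs n)
  pairs-ordered = All.tabulate ∈-pairs⁻

  adj : Graph n → Fin n → Fin n → Bool
  adj g = adjacentIn (pairs n) (toList g)

  fromAdj : (Fin n → Fin n → Bool) → Graph n
  fromAdj E = Vec-over (uncurry E) (pairs n)

  fromAdj-cong : {E E′ : Fin n → Fin n → Bool} → (∀ u v → E u v ≡ E′ u v) → fromAdj E ≡ fromAdj E′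
  fromAdj-cong E≗E′ = Vec-over-cong (pairs n) λ {(u , v)} _ → E≗E′ u v

  adj-sym : ∀ g u v → adj g u v ≡ adj g v u
  adj-sym g = adjacentIn-sym (pairs n) (toList g)

  adj-irrefl : ∀ g u → adj g u u ≡ false
  adj-irrefl g = adjacentIn-irrefl (toList g) pairs-ordered

  deg-adj : ∀ g v → deg g v ≡ count (adj g v)
  deg-adj g = incident-adjacentIn (toList g) pairs-unique pairs-ordered

  fromAdj-adj : ∀ g → fromAdj (adj g) ≡ g
  fromAdj-adj g = Vec-over-adjacentIn g pairs-unique pairs-ordered

  adj-fromAdj : {E : Fin n → Fin n → Bool} → (∀ u v → E u v ≡ E v u) → (∀ u → E u u ≡ false) →
                ∀ u v → adj (fromAdj E) u v ≡ E u v
  adj-fromAdj E-sym E-irrefl u v with Finₚ.<-cmp u v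
  ... | tri< u<v _ _ = adjacentIn-Vec-over E-sym (pairs n) (inj₁ (lose (∈-pairs⁺ u<v) (joins-refl u v)))
  ... | tri≈ _ refl _ = adjacentIn-Vec-over E-sym (pairs n) (inj₂ (E-irrefl u))
  ... | tri> _ _ v<u = adjacentIn-Vec-over E-sym (pairs n)
                         (inj₁ (lose (∈-pairs⁺ v<u) (trans (joins-sym (v , u) u v) (joins-refl v u))))

-- Swapping neighbours between i and j

-- trit a x y classifies a vertex w by a = [w ∈ {i, j}], x = [w ~ i], y = [w ~ j]:
-- up when w is joined to i only, dn when joined to j only, nil otherwise.
trit : Bool → Bool → Bool → Trit
trit true _ _ = nil
trit false true false = up
trit false false true = dn
trit false _ _ = nil

trit-xor : ∀ x y m → trit false (x xor m) (y xor m) ≡ swapIf m (trit false x y)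
trit-xor true true true = refl
trit-xor true true false = refl
trit-xor true false true = refl
trit-xor true false false = refl
trit-xor false true true = refl
trit-xor false true false = refl
trit-xor false false true = refl
trit-xor false false false = refl

∧-up : ∀ a x y m → SupportedAt m (trit a x y) → x ∧ m ≡ m ∧ isUp (trit a x y)
∧-up a x y false _ = ∧-zeroʳ x
∧-up false true false true _ = refl
∧-up false false true true _ = refl
∧-up false true true true s with () ← s refl
∧-up false false false true s with () ← s refl
∧-up true x y true s with () ← s refl

∧-dn : ∀ a x y m → SupportedAt m (trit a x y) → y ∧ m ≡ m ∧ isDn (trit a x y)
∧-dn a x y false _ = ∧-zeroʳ y
∧-dn false true false true _ = refl
∧-dn false false true true _ = refl
∧-dn false true true true s with () ← s refl
∧-dn false false false true s with () ← s refl
∧-dn true x y true s with () ← s refl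

∧-not-up : ∀ a x y m → SupportedAt m (trit a x y) → m ∧ not (isUp (trit a x y)) ≡ m ∧ isDn (trit a x y)
∧-not-up a x y false _ = refl
∧-not-up false true false true _ = refl
∧-not-up false false true true _ = refl
∧-not-up false true true true s with () ← s refl
∧-not-up false false false true s with () ← s refl
∧-not-up true x y true s with () ← s refl

nonNil-joined-once : ∀ x y → nonNil (trit false x y) ≡ true → bit x + bit y ≡ 1
nonNil-joined-once true false _ = refl
nonNil-joined-once false true _ = refl
nonNil-joined-once true true ()
nonNil-joined-once false false ()

degree-difference-at : ∀ a x y →
  bit (x ∧ not a) + bit (isDn (trit a x y)) ≡ bit (y ∧ not a) + bit (isUp (trit a x y))
degree-difference-at true x y rewrite ∧-zeroʳ x | ∧-zeroʳ y = refl
degree-difference-at false true true = refl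
degree-difference-at false true false = refl
degree-difference-at false false true = refl
degree-difference-at false false false = refl

private
  cancel-i : ∀ x c d → x + 2 * (d + 1) ≡ c + ((d + 1) + d) → c ≡ x + 1
  cancel-i x c d eq = +-cancelʳ-≡ (2 * d + 1) c (x + 1) (begin
    c + (2 * d + 1)        ≡⟨ lhs c d ⟩
    c + ((d + 1) + d)      ≡⟨ eq ⟨
    x + 2 * (d + 1)        ≡⟨ rhs x d ⟩
    x + 1 + (2 * d + 1)    ∎)
    where
    open ≡-Reasoning
    lhs : ∀ c d → c + (2 * d + 1) ≡ c + ((d + 1) + d)
    lhs = solve-∀
    rhs : ∀ x d → x + 2 * (d + 1) ≡ x + 1 + (2 * d + 1)
    rhs = solve-∀

  cancel-j : ∀ y c d → y + 2 * d ≡ c + ((d + 1) + d) → y ≡ c + 1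
  cancel-j y c d eq = +-cancelʳ-≡ (2 * d) y (c + 1) (trans eq (rearrange c d))
    where
    rearrange : ∀ c d → c + ((d + 1) + d) ≡ c + 1 + 2 * d
    rearrange = solve-∀

module AtPair {n : ℕ} {i j : Fin n} (i≢j : i ≢ j) where

  atIJ : Fin n → Bool
  atIJ u = ⌊ u ≟ i ⌋ ∨ ⌊ u ≟ j ⌋

  atIJ-i : atIJ i ≡ true
  atIJ-i with i ≟ i
  ... | yes _ = refl
  ... | no i≢i = ⊥-elim (i≢i refl)

  atIJ-j : atIJ j ≡ true
  atIJ-j with j ≟ j
  ... | yes _ = ∨-zeroʳ ⌊ j ≟ i ⌋
  ... | no j≢j = ⊥-elim (j≢j refl)

  atIJ-outside : ∀ {w} → w ≢ i → w ≢ j → atIJ w ≡ false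
  atIJ-outside {w} w≢i w≢j with w ≟ i | w ≟ j
  ... | yes w≡i | _ = ⊥-elim (w≢i w≡i)
  ... | no _ | yes w≡j = ⊥-elim (w≢j w≡j)
  ... | no _ | no _ = refl

  profileAt : (Fin n → Fin n → Bool) → Fin n → Trit
  profileAt A w = trit (atIJ w) (A i w) (A j w)

  profile : (Fin n → Fin n → Bool) → Vec Trit n
  profile A = tabulate (profileAt A)

  lookup-profile : ∀ A w → lookup (profile A) w ≡ profileAt A w
  lookup-profile A = lookup∘tabulate (profileAt A)

  -- Toggle the edges w–i and w–j for every w in M.
  swapAlong : (Fin n → Fin n → Bool) → Vec Bool n → Fin n → Fin n → Bool
  swapAlong A M u v = A u v xor ((atIJ u ∧ lookup M v) xor (atIJ v ∧ lookup M u))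

  swapAlong-sym : ∀ {A} → (∀ u v → A u v ≡ A v u) → ∀ M u v → swapAlong A M u v ≡ swapAlong A M v u
  swapAlong-sym A-sym M u v =
    cong₂ _xor_ (A-sym u v) (xor-comm (atIJ u ∧ lookup M v) (atIJ v ∧ lookup M u))

  swapAlong-irrefl : ∀ {A} → (∀ u → A u u ≡ false) → ∀ M u → swapAlong A M u u ≡ false
  swapAlong-irrefl A-irrefl M u rewrite A-irrefl u = xor-same (atIJ u ∧ lookup M u)

  swapAlong-involutive : ∀ A M u v → swapAlong (swapAlong A M) M u v ≡ A u v
  swapAlong-involutive A M u v = begin
    (A u v xor t) xor t    ≡⟨ xor-assoc (A u v) t t ⟩
    A u v xor (t xor t)    ≡⟨ cong (A u v xor_) (xor-same t) ⟩
    A u v xor false        ≡⟨ xor-identityʳ (A u v) ⟩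
    A u v                  ∎
    where
    open ≡-Reasoning
    t : Bool
    t = (atIJ u ∧ lookup M v) xor (atIJ v ∧ lookup M u)

  swapAlong-across : ∀ A M {u v} → atIJ u ≡ true → atIJ v ≡ false → swapAlong A M u v ≡ A u v xor lookup M v
  swapAlong-across A M {u} {v} u∈ v∉ =
    trans (cong₂ (λ a b → A u v xor ((a ∧ lookup M v) xor (b ∧ lookup M u))) u∈ v∉)
          (cong (A u v xor_) (xor-identityʳ (lookup M v)))

  profile-swapAlong : ∀ A M → profile (swapAlong A M) ≡ swapAt M (profile A)
  profile-swapAlong A M = trans (tabulate-cong pointwise) (tabulate∘lookup (swapAt M (profile A)))
    where
    open ≡-Reasoning
    pointwise : ∀ w → profileAt (swapAlong A M) w ≡ lookup (swapAt M (profile A)) w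
    pointwise w rewrite lookup-zipWith swapIf w M (profile A) | lookup-profile A w =
      by-cases (atIJ w) refl
      where
      F : Fin n → Fin n → Bool
      F = swapAlong A M
      m : Bool
      m = lookup M w
      by-cases : ∀ b → atIJ w ≡ b → trit (atIJ w) (F i w) (F j w) ≡ swapIf m (trit (atIJ w) (A i w) (A j w))
      by-cases true w∈ = begin
        trit (atIJ w) (F i w) (F j w)          ≡⟨ cong (λ a → trit a (F i w) (F j w)) w∈ ⟩
        nil                                    ≡⟨ swapIf-nil m ⟨
        swapIf m nil                           ≡⟨ cong (λ a → swapIf m (trit a (A i w) (A j w))) w∈ ⟨
        swapIf m (trit (atIJ w) (A i w) (A j w)) ∎
      by-cases false w∉ = begin
        trit (atIJ w) (F i w) (F j w)          ≡⟨ cong (λ a → trit a (F i w) (F j w)) w∉ ⟩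
        trit false (F i w) (F j w)             ≡⟨ cong₂ (trit false) (swapAlong-across A M atIJ-i w∉)
                                                                     (swapAlong-across A M atIJ-j w∉) ⟩
        trit false (A i w xor m) (A j w xor m) ≡⟨ trit-xor (A i w) (A j w) m ⟩
        swapIf m (trit false (A i w) (A j w))  ≡⟨ cong (λ a → swapIf m (trit a (A i w) (A j w))) w∉ ⟨
        swapIf m (trit (atIJ w) (A i w) (A j w)) ∎

  module _ {A : Fin n → Fin n → Bool} {M : Vec Bool n} (M-supported : Supported M (profile A)) where

    private
      U D : ℕ
      U = upsAt M (profile A)
      D = dnsAt M (profile A)

      supported-at : ∀ w → SupportedAt (lookup M w) (profileAt A w)
      supported-at w = subst (SupportedAt (lookup M w)) (lookup-profile A w) (Pointwise.lookup M-supported w)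

      off-ij : ∀ {w} → atIJ w ≡ true → lookup M w ≡ false
      off-ij {w} w∈ = ¬-not λ Mw →
        case trans (cong (λ a → nonNil (trit a (A i w) (A j w))) (sym w∈)) (supported-at w Mw) of λ ()

      count-∧-i : count (λ u → A i u ∧ lookup M u) ≡ U
      count-∧-i = count-cong λ u →
        trans (∧-up _ _ _ _ (supported-at u)) (cong (λ t → lookup M u ∧ isUp t) (sym (lookup-profile A u)))

      count-∧-j : count (λ u → A j u ∧ lookup M u) ≡ D
      count-∧-j = count-cong λ u →
        trans (∧-dn _ _ _ _ (supported-at u)) (cong (λ t → lookup M u ∧ isDn t) (sym (lookup-profile A u)))

      count-mask : count (lookup M) ≡ U + D
      count-mask = trans (count-split (lookup M) (isUp ∘ lookup (profile A))) (cong (U +_) (count-cong not-up))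
        where
        not-up : ∀ u → lookup M u ∧ not (isUp (lookup (profile A) u)) ≡ lookup M u ∧ isDn (lookup (profile A) u)
        not-up u rewrite lookup-profile A u = ∧-not-up _ _ _ _ (supported-at u)

      swapAlong-from : ∀ {v} → atIJ v ≡ true → ∀ u → swapAlong A M v u ≡ A v u xor lookup M u
      swapAlong-from {v} v∈ u = begin
        A v u xor ((atIJ v ∧ lookup M u) xor (atIJ u ∧ lookup M v))
          ≡⟨ cong₂ (λ a b → A v u xor ((a ∧ lookup M u) xor (atIJ u ∧ b))) v∈ (off-ij v∈) ⟩
        A v u xor (lookup M u xor (atIJ u ∧ false))
          ≡⟨ cong (λ b → A v u xor (lookup M u xor b)) (∧-zeroʳ (atIJ u)) ⟩
        A v u xor (lookup M u xor false)
          ≡⟨ cong (A v u xor_) (xor-identityʳ (lookup M u)) ⟩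
        A v u xor lookup M u ∎
        where open ≡-Reasoning

      count-swapAlong-from : ∀ {v} → atIJ v ≡ true →
        count (swapAlong A M v) + 2 * count (λ u → A v u ∧ lookup M u) ≡ count (A v) + (U + D)
      count-swapAlong-from {v} v∈ = begin
        count (swapAlong A M v) + 2 * count (λ u → A v u ∧ lookup M u)
          ≡⟨ cong (_+ 2 * count (λ u → A v u ∧ lookup M u)) (count-cong (swapAlong-from v∈)) ⟩
        count (λ u → A v u xor lookup M u) + 2 * count (λ u → A v u ∧ lookup M u)
          ≡⟨ count-xor (A v) (lookup M) ⟩
        count (A v) + count (lookup M)
          ≡⟨ cong (count (A v) +_) count-mask ⟩
        count (A v) + (U + D) ∎
        where open ≡-Reasoning

    count-swapAlong-outside : (∀ u v → A u v ≡ A v u) → ∀ {w} → w ≢ i → w ≢ j →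
                              count (swapAlong A M w) ≡ count (A w)
    count-swapAlong-outside A-sym {w} w≢i w≢j = by-cases (lookup M w) refl
      where
      open ≡-Reasoning
      w∉ : atIJ w ≡ false
      w∉ = atIJ-outside w≢i w≢j
      swapAlong-w : ∀ u → swapAlong A M w u ≡ A w u xor (atIJ u ∧ lookup M w)
      swapAlong-w u = cong (λ a → A w u xor ((a ∧ lookup M u) xor (atIJ u ∧ lookup M w))) w∉
      by-cases : ∀ b → lookup M w ≡ b → count (swapAlong A M w) ≡ count (A w)
      by-cases false Mw = count-cong λ u → begin
        swapAlong A M w u               ≡⟨ swapAlong-w u ⟩
        A w u xor (atIJ u ∧ lookup M w) ≡⟨ cong (λ b → A w u xor (atIJ u ∧ b)) Mw ⟩
        A w u xor (atIJ u ∧ false)      ≡⟨ cong (A w u xor_) (∧-zeroʳ (atIJ u)) ⟩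
        A w u xor false                 ≡⟨ xor-identityʳ (A w u) ⟩
        A w u                           ∎
      by-cases true Mw = +-cancelʳ-≡ 2 _ _ (begin
        count (swapAlong A M w) + 2
          ≡⟨ cong (λ x → count (swapAlong A M w) + 2 * x) joined-once ⟨
        count (swapAlong A M w) + 2 * count (λ u → A w u ∧ atIJ u)
          ≡⟨ cong (_+ 2 * count (λ u → A w u ∧ atIJ u)) (count-cong swapAlong-atIJ) ⟩
        count (λ u → A w u xor atIJ u) + 2 * count (λ u → A w u ∧ atIJ u)
          ≡⟨ count-xor (A w) atIJ ⟩
        count (A w) + count atIJ
          ≡⟨ cong (count (A w) +_) (count-at-pair i≢j λ _ → true) ⟩
        count (A w) + 2 ∎)
        where
        swapAlong-atIJ : ∀ u → swapAlong A M w u ≡ A w u xor atIJ u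
        swapAlong-atIJ u rewrite swapAlong-w u | Mw = cong (A w u xor_) (∧-identityʳ (atIJ u))
        w-nonNil : nonNil (trit false (A i w) (A j w)) ≡ true
        w-nonNil = trans (cong (λ a → nonNil (trit a (A i w) (A j w))) (sym w∉)) (supported-at w Mw)
        joined-once : count (λ u → A w u ∧ atIJ u) ≡ 1
        joined-once = begin
          count (λ u → A w u ∧ atIJ u)  ≡⟨ count-at-pair i≢j (A w) ⟩
          bit (A w i) + bit (A w j)     ≡⟨ cong₂ (λ x y → bit x + bit y) (A-sym w i) (A-sym w j) ⟩
          bit (A i w) + bit (A j w)     ≡⟨ nonNil-joined-once (A i w) (A j w) w-nonNil ⟩
          1                             ∎

    module _ (balanced : Balanced M (profile A)) where

      count-swapAlong-i : count (A i) ≡ count (swapAlong A M i) + 1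
      count-swapAlong-i = cancel-i _ _ D (begin
        count (swapAlong A M i) + 2 * (D + 1)
          ≡⟨ cong (λ x → count (swapAlong A M i) + 2 * x) (trans (sym balanced) (sym count-∧-i)) ⟩
        count (swapAlong A M i) + 2 * count (λ u → A i u ∧ lookup M u)
          ≡⟨ count-swapAlong-from atIJ-i ⟩
        count (A i) + (U + D)
          ≡⟨ cong (λ x → count (A i) + (x + D)) balanced ⟩
        count (A i) + ((D + 1) + D) ∎)
        where open ≡-Reasoning

      count-swapAlong-j : count (swapAlong A M j) ≡ count (A j) + 1
      count-swapAlong-j = cancel-j _ _ D (begin
        count (swapAlong A M j) + 2 * D
          ≡⟨ cong (λ x → count (swapAlong A M j) + 2 * x) (sym count-∧-j) ⟩
        count (swapAlong A M j) + 2 * count (λ u → A j u ∧ lookup M u)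
          ≡⟨ count-swapAlong-from atIJ-j ⟩
        count (A j) + (U + D)
          ≡⟨ cong (λ x → count (A j) + (x + D)) balanced ⟩
        count (A j) + ((D + 1) + D) ∎)
        where open ≡-Reasoning

  degree-difference : ∀ {A} → (∀ u v → A u v ≡ A v u) → (∀ u → A u u ≡ false) →
                      count (A i) + dns (profile A) ≡ count (A j) + ups (profile A)
  degree-difference {A} A-sym A-irrefl = begin
    count (A i) + D                     ≡⟨ cong (_+ D) (count-split (A i) atIJ) ⟩
    (count (λ u → A i u ∧ atIJ u) + Rᵢ) + D ≡⟨ cong (λ x → (x + Rᵢ) + D) (count-at-pair i≢j (A i)) ⟩
    (bit (A i i) + bit (A i j) + Rᵢ) + D ≡⟨ cong (λ x → (x + bit (A i j) + Rᵢ) + D) (cong bit (A-irrefl i)) ⟩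
    (bit (A i j) + Rᵢ) + D              ≡⟨ +-assoc (bit (A i j)) Rᵢ D ⟩
    bit (A i j) + (Rᵢ + D)              ≡⟨ cong (bit (A i j) +_) outside ⟩
    bit (A i j) + (Rⱼ + U)              ≡⟨ +-assoc (bit (A i j)) Rⱼ U ⟨
    (bit (A i j) + Rⱼ) + U              ≡⟨ cong (λ x → (x + Rⱼ) + U) (+-identityʳ (bit (A i j))) ⟨
    (bit (A i j) + 0 + Rⱼ) + U          ≡⟨ cong₂ (λ x y → (bit x + bit y + Rⱼ) + U) (A-sym i j) (sym (A-irrefl j)) ⟩
    (bit (A j i) + bit (A j j) + Rⱼ) + U ≡⟨ cong (λ x → (x + Rⱼ) + U) (count-at-pair i≢j (A j)) ⟨
    (count (λ u → A j u ∧ atIJ u) + Rⱼ) + U ≡⟨ cong (_+ U) (count-split (A j) atIJ) ⟨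
    count (A j) + U                     ∎
    where
    open ≡-Reasoning
    D U Rᵢ Rⱼ : ℕ
    D = dns (profile A)
    U = ups (profile A)
    Rᵢ = count (λ u → A i u ∧ not (atIJ u))
    Rⱼ = count (λ u → A j u ∧ not (atIJ u))
    pointwise : ∀ u → bit (A i u ∧ not (atIJ u)) + bit (isDn (lookup (profile A) u))
                    ≡ bit (A j u ∧ not (atIJ u)) + bit (isUp (lookup (profile A) u))
    pointwise u rewrite lookup-profile A u = degree-difference-at (atIJ u) (A i u) (A j u)
    outside : Rᵢ + D ≡ Rⱼ + U
    outside = begin
      Rᵢ + D
        ≡⟨ ∑-distrib-+ (λ u → bit (A i u ∧ not (atIJ u))) (bit ∘ isDn ∘ lookup (profile A)) ⟨
      sum (λ u → bit (A i u ∧ not (atIJ u)) + bit (isDn (lookup (profile A) u)))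
        ≡⟨ sum-cong-≗ pointwise ⟩
      sum (λ u → bit (A j u ∧ not (atIJ u)) + bit (isUp (lookup (profile A) u)))
        ≡⟨ ∑-distrib-+ (λ u → bit (A j u ∧ not (atIJ u))) (bit ∘ isUp ∘ lookup (profile A)) ⟩
      Rⱼ + U ∎

  swapG : Graph n → Vec Bool n → Graph n
  swapG g M = fromAdj (swapAlong (adj g) M)

  adj-swapG : ∀ g M u v → adj (swapG g M) u v ≡ swapAlong (adj g) M u v
  adj-swapG g M = adj-fromAdj (swapAlong-sym {adj g} (adj-sym g) M) (swapAlong-irrefl {adj g} (adj-irrefl g) M)

  profile-swapG : ∀ g M → profile (adj (swapG g M)) ≡ swapAt M (profile (adj g))
  profile-swapG g M =
    trans (tabulate-cong λ w → cong₂ (trit (atIJ w)) (adj-swapG g M i w) (adj-swapG g M j w))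
          (profile-swapAlong (adj g) M)

  swapG-involutive : ∀ g M → swapG (swapG g M) M ≡ g
  swapG-involutive g M = trans (fromAdj-cong twice) (fromAdj-adj g)
    where
    twice : ∀ u v → swapAlong (adj (swapG g M)) M u v ≡ adj g u v
    twice u v = trans (cong (_xor _) (adj-swapG g M u v)) (swapAlong-involutive (adj g) M u v)

  moveOne moveBack : Graph n → Graph n
  moveOne g = swapG g (ballot 1 (profile (adj g)))
  moveBack h = swapG h (ballot 1 (swapAll (profile (adj h))))

  moveBack-moveOne : ∀ g → moveBack (moveOne g) ≡ g
  moveBack-moveOne g = begin
    swapG (moveOne g) (ballot 1 (swapAll (profile (adj (moveOne g)))))
      ≡⟨ cong (λ t → swapG (moveOne g) (ballot 1 (swapAll t))) (profile-swapG g M) ⟩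
    swapG (moveOne g) (ballot 1 (swapAll (swapAt M (profile (adj g)))))
      ≡⟨ cong (swapG (moveOne g)) (ballot-swapAll-swapAt 1 (profile (adj g))) ⟩
    swapG (swapG g M) M
      ≡⟨ swapG-involutive g M ⟩
    g ∎
    where
    open ≡-Reasoning
    M : Vec Bool n
    M = ballot 1 (profile (adj g))

  open import Data.Integer using (+_)

  module Transfer (a a′ : Vec ℤ n)
    (gap : lookup a′ j ℤ.+ + 2 ℤ.≤ lookup a′ i)
    (a-i : lookup a i ≡ lookup a′ i ℤ.- + 1)
    (a-j : lookup a j ≡ lookup a′ j ℤ.+ + 1)
    (a-k : ∀ k → k ≢ i → k ≢ j → lookup a k ≡ lookup a′ k)
    where

    private
      count-adj : ∀ {g} → Realizes a′ g → ∀ v → + count (adj g v) ≡ lookup a′ v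
      count-adj {g} R v = trans (cong +_ (sym (deg-adj g v))) (R v)

      i+1-1≡i : ∀ x → x ℤ.+ + 1 ℤ.- + 1 ≡ x
      i+1-1≡i x = trans (ℤₚ.+-assoc x (+ 1) (ℤ.- + 1)) (ℤₚ.+-identityʳ x)

    realization-gap : ∀ {g} → Realizes a′ g → 2 + dns (profile (adj g)) ≤ ups (profile (adj g))
    realization-gap {g} R = +-cancelˡ-≤ (count (adj g j)) _ _ (begin
      count (adj g j) + (2 + D)   ≡⟨ +-assoc (count (adj g j)) 2 D ⟨
      count (adj g j) + 2 + D     ≤⟨ +-monoˡ-≤ D degree-gap ⟩
      count (adj g i) + D         ≡⟨ degree-difference (adj-sym g) (adj-irrefl g) ⟩
      count (adj g j) + ups (profile (adj g)) ∎)
      where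
      open Data.Nat.Properties.≤-Reasoning
      D : ℕ
      D = dns (profile (adj g))
      degree-gap : count (adj g j) + 2 ≤ count (adj g i)
      degree-gap = ℤₚ.drop‿+≤+ (subst₂ (λ x y → x ℤ.+ + 2 ℤ.≤ y) (sym (count-adj R j)) (sym (count-adj R i)) gap)

    realization-reaches : ∀ {g} → Realizes a′ g → Reaches 1 (profile (adj g))
    realization-reaches {g} R = reaches 1 (profile (adj g)) (≤-trans (n≤1+n _) (realization-gap R))

    swapG-realizes : ∀ {g M} → Realizes a′ g → Supported M (profile (adj g)) → Balanced M (profile (adj g)) →
                     Realizes a (swapG g M)
    swapG-realizes {g} {M} R S B v =
      trans (cong +_ (trans (deg-adj (swapG g M) v) (count-cong (adj-swapG g M v)))) (at v (v ≟ i) (v ≟ j))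
      where
      open ≡-Reasoning
      at : ∀ v → Dec (v ≡ i) → Dec (v ≡ j) → + count (swapAlong (adj g) M v) ≡ lookup a v
      at _ (yes refl) _ = begin
        + count (swapAlong (adj g) M i)               ≡⟨ i+1-1≡i _ ⟨
        + (count (swapAlong (adj g) M i) + 1) ℤ.- + 1 ≡⟨ cong (λ x → + x ℤ.- + 1) (count-swapAlong-i S B) ⟨
        + count (adj g i) ℤ.- + 1                     ≡⟨ cong (ℤ._- + 1) (count-adj R i) ⟩
        lookup a′ i ℤ.- + 1                           ≡⟨ a-i ⟨
        lookup a i                                    ∎
      at _ (no _) (yes refl) = begin
        + count (swapAlong (adj g) M j)  ≡⟨ cong +_ (count-swapAlong-j S B) ⟩
        + count (adj g j) ℤ.+ + 1        ≡⟨ cong (ℤ._+ + 1) (count-adj R j) ⟩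
        lookup a′ j ℤ.+ + 1              ≡⟨ a-j ⟨
        lookup a j                       ∎
      at v (no v≢i) (no v≢j) = begin
        + count (swapAlong (adj g) M v)  ≡⟨ cong +_ (count-swapAlong-outside S (adj-sym g) v≢i v≢j) ⟩
        + count (adj g v)                ≡⟨ count-adj R v ⟩
        lookup a′ v                      ≡⟨ a-k v v≢i v≢j ⟨
        lookup a v                       ∎

    moveOne-realizes : ∀ {g} → Realizes a′ g → Realizes a (moveOne g)
    moveOne-realizes {g} R = swapG-realizes R (ballot-supported 1 (profile (adj g)))
                                              (ballot-balanced 1 (profile (adj g)) (realization-reaches R))

    unmovable : ∀ {g₀} → Realizes a′ g₀ → ∃ λ h → Realizes a h × (∀ g → Realizes a′ g → moveOne g ≢ h)
    unmovable {g₀} R₀ with unreachable-swap (profile (adj g₀)) (realization-gap R₀)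
    ... | M , S , B , unreached = swapG g₀ M , swapG-realizes R₀ S B , λ g R moveOne≡ →
      unreached (profile (adj g)) (realization-reaches R)
        (trans (sym (profile-swapG g _)) (trans (cong (profile ∘ adj) moveOne≡) (profile-swapG g₀ M)))

theorem15 : (n : ℕ) (a a' : Vec ℤ n) (i j : Fin n) →
    Nonincreasing a → UnitTransfer a' i j a →
    (N₃ a' ≤ N₃ a) × (Graphic a' → N₃ a' < N₃ a)
theorem15 n a a' i j _ (i<j , gap , a-i , a-j , a-k) =
  length-filter-≤ , λ (g₀ , R₀) → let h , Rh , h∉image = unmovable R₀ in length-filter-< h Rh h∉image
  where
  open AtPair (Finₚ.<⇒≢ i<j)
  open Transfer a a' gap a-i a-j a-k
  open CountByInjection (allVecs _) (allVecs-unique _) (∈-allVecs _) (realizes? a') (realizes? a)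
                        moveOne moveBack moveBack-moveOne moveOne-realizes
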